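{- The pair $(H,V_{\mathrm{solve}})$ is a violator space.
   Context: $K$ is a field, $\mathfrak{R}=K[x_0,\dots,x_n]$, and $H\subset\mathfrak{R}$ is a finite set of polynomials. For a set $S$ of polynomials, $\mathcal{V}(S)$ denotes the affine variety defined by $S$. The operator $V_{\mathrm{solve}}:2^H\to 2^H$ is defined by $V_{\mathrm{solve}}(S)=\{f\in H:\ \mathcal{V}(S)\text{ is not contained in }\mathcal{V}(f)\}$. A violator space is a pair $(H,V)$ with $H$ a finite set and $V:2^H\to2^H$ a mapping satisfying Consistency: $G\cap V(G)=\emptyset$ for all $G\subseteq H$; and Locality: $V(G)=V(F)$ for all $F\subseteq G\subseteq H$ with $G\cap V(F)=\emptyset$. -}

module Defs where

open import Level using (Level; _⊔_; suc)
open import Algebra.Bundles using (CommutativeRing)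
open import Data.Nat using (ℕ)
import Data.Nat as ℕ
open import Data.Fin using (Fin)
open import Data.Vec using (Vec; lookup)
open import Data.List using (List; []; _∷_)
open import Data.Product using (_×_; _,_; ∃)
open import Relation.Nullary using (¬_)
open import Relation.Unary using (Pred)
open import Data.Empty using (⊥)

record Field (c ℓ : Level) : Set (suc (c ⊔ ℓ)) where
  field
    commutativeRing : CommutativeRing c ℓ
  open CommutativeRing commutativeRing public
  field
    1≉0     : ¬ (1# ≈ 0#)
    inverse : ∀ x → ¬ (x ≈ 0#) → ∃ λ y → x * y ≈ 1#

module _ {c ℓ : Level} (K : Field c ℓ) where
  open Field K

  -- Polynomials in K[x_0,…,x_n] (N = n+1 variables), in sparse
  -- representation: a finite list of terms (coefficient, exponent vector).
  Poly : ℕ → Set c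
  Poly N = List (Carrier × Vec ℕ N)

  Point : ℕ → Set c
  Point N = Fin N → Carrier

  _^_ : Carrier → ℕ → Carrier
  x ^ ℕ.zero  = 1#
  x ^ ℕ.suc k = x * (x ^ k)

  monomial : ∀ {N} → Vec ℕ N → Point N → Carrier
  monomial {ℕ.zero}  e p = 1#
  monomial {ℕ.suc N} e p =
    (p Fin.zero ^ lookup e Fin.zero)
      * monomial (Data.Vec.tail e) (λ i → p (Fin.suc i))
    where import Data.Fin as Fin

  eval : ∀ {N} → Poly N → Point N → Carrier
  eval []            p = 0#
  eval ((a , e) ∷ f) p = a * monomial e p + eval f p

  𝒱₁ : ∀ {N} → Poly N → Pred (Point N) ℓ
  𝒱₁ f p = eval f p ≈ 0#

  -- H = {h_0,…,h_{m-1}} is a finite set of polynomials, given by an indexing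
  -- h : Fin m → Poly N; subsets of H are predicates on the index set Fin m.
  SubsetOf : ℕ → (ℓ' : Level) → Set (suc ℓ')
  SubsetOf m ℓ' = Pred (Fin m) ℓ'

  𝒱 : ∀ {N m ℓ'} → (Fin m → Poly N) → SubsetOf m ℓ' → Pred (Point N) (ℓ ⊔ ℓ')
  𝒱 h S p = ∀ i → S i → 𝒱₁ (h i) p

  _⊆𝒱_ : ∀ {N ℓ₁} → Pred (Point N) ℓ₁ → Pred (Point N) ℓ → Set (c ⊔ ℓ ⊔ ℓ₁)
  A ⊆𝒱 B = ∀ p → A p → B p

  Vsolve : ∀ {N m} → (Fin m → Poly N) → SubsetOf m (c ⊔ ℓ) → SubsetOf m (c ⊔ ℓ)
  Vsolve h S i = ¬ (𝒱 h S ⊆𝒱 𝒱₁ (h i))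

-- Violator spaces (H, V), with H = Fin m and subsets of H as predicates
-- on Fin m (of a fixed universe level ℓ').
module _ {m : ℕ} {ℓ' : Level} where
  private
    Sub : Set (suc ℓ')
    Sub = Pred (Fin m) ℓ'

  _⊆ₛ_ : Sub → Sub → Set ℓ'
  F ⊆ₛ G = ∀ i → F i → G i

  _≐ₛ_ : Sub → Sub → Set ℓ'
  F ≐ₛ G = ∀ i → (F i → G i) × (G i → F i)

  Disjoint : Sub → Sub → Set ℓ'
  Disjoint F G = ∀ i → F i → G i → ⊥

  record IsViolatorSpace (V : Sub → Sub) : Set (suc ℓ') where
    field
      consistency : ∀ (G : Sub) → Disjoint G (V G)
      locality    : ∀ (F G : Sub) → F ⊆ₛ G → Disjoint G (V F) → V G ≐ₛ V F

module Submission where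

-- The violator-space axioms for V_solve follow from two facts about
-- varieties.  Writing 𝒱(S) for the common zero set of S ⊆ H:
--
--  * 𝒱 is antitone (F ⊆ G ⇒ 𝒱(G) ⊆ 𝒱(F)), and 𝒱(F) ⊆ 𝒱(G) as soon as
--    𝒱(F) ⊆ 𝒱(h) for every h ∈ G;
--  * V_solve is monotone along inclusions of varieties:
--    𝒱(G) ⊆ 𝒱(F) ⇒ V_solve(G) ⊆ V_solve(F).
--
-- Consistency holds because every member of S vanishes on 𝒱(S).  For
-- locality, F ⊆ G gives V_solve(G) ⊆ V_solve(F); conversely, G ∩ V_solve(F) = ∅
-- says 𝒱(F) ⊆ 𝒱(h) for every h ∈ G, hence 𝒱(F) = 𝒱(G) and the reverse
-- inclusion.  Constructively "h ∉ V_solve(F)" only yields 𝒱(F) ⊆ 𝒱(h) up to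
-- double negation; since H is finite these combine (double-negation shift
-- over Fin m) into ¬¬(𝒱(F) ⊆ 𝒱(G)), which suffices because V_solve(·) is
-- itself a negated statement.

open import Defs
open import Level using (Level; _⊔_)
open import Data.Nat using (ℕ; suc)
open import Data.Fin using (Fin)
open import Data.Fin.Properties using (sequence)
open import Data.Product using (_,_)
open import Data.Empty using (⊥-elim)
open import Effect.Monad using (RawMonad)
open import Relation.Nullary using (¬_)
open import Relation.Nullary.Negation using (¬¬-Monad; contradiction)
open import Relation.Unary using (Pred; _⊆′_)
open import Relation.Unary.Properties using (⊆′-trans)

-- Double-negation shift over a finite index set: the double-negation
-- monad is applicative, so it commutes with finite products.
¬¬-shift-Fin : ∀ {a k} {Q : Fin k → Set a} → (∀ j → ¬ ¬ Q j) → ¬ ¬ (∀ j → Q j)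
¬¬-shift-Fin = sequence (RawMonad.rawApplicative ¬¬-Monad)

¬¬-under-premise : ∀ {a b} {A : Set a} {B : Set b} → (A → ¬ ¬ B) → ¬ ¬ (A → B)
¬¬-under-premise f ¬[a→b] = ¬[a→b] (λ a → ⊥-elim (f a (λ b → ¬[a→b] (λ _ → b))))

module Varieties {c ℓ : Level} (K : Field c ℓ) {N m : ℕ} (h : Fin m → Poly K N) where

  𝒱-member : ∀ {ℓ'} {S : SubsetOf K m ℓ'} {i} → S i → 𝒱 K h S ⊆′ 𝒱₁ K (h i)
  𝒱-member {i = i} Si p p∈𝒱S = p∈𝒱S i Si

  𝒱-antitone : ∀ {ℓ'} {F G : SubsetOf K m ℓ'} → F ⊆ₛ G → 𝒱 K h G ⊆′ 𝒱 K h F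
  𝒱-antitone F⊆G p p∈𝒱G i Fi = p∈𝒱G i (F⊆G i Fi)

  𝒱-greatest : ∀ {ℓ₁ ℓ'} {A : Pred (Point K N) ℓ₁} {G : SubsetOf K m ℓ'} →
               (∀ j → G j → A ⊆′ 𝒱₁ K (h j)) → A ⊆′ 𝒱 K h G
  𝒱-greatest A⊆ p p∈A j Gj = A⊆ j Gj p p∈A

  -- V_solve is monotone along inclusions of varieties; as V_solve(S) is a
  -- negated property, the inclusion is only needed up to double negation.
  Vsolve-mono : ∀ {F G : SubsetOf K m (c ⊔ ℓ)} →
                ¬ ¬ (𝒱 K h G ⊆′ 𝒱 K h F) → Vsolve K h G ⊆ₛ Vsolve K h F
  Vsolve-mono ¬¬𝒱G⊆𝒱F i 𝒱F⊈hᵢ 𝒱G⊆hᵢ =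
    ¬¬𝒱G⊆𝒱F (λ 𝒱G⊆𝒱F → 𝒱F⊈hᵢ (⊆′-trans 𝒱G⊆𝒱F 𝒱G⊆hᵢ))

  disjoint⇒𝒱⊆ : ∀ {F G : SubsetOf K m (c ⊔ ℓ)} →
                 Disjoint G (Vsolve K h F) → ¬ ¬ (𝒱 K h F ⊆′ 𝒱 K h G)
  disjoint⇒𝒱⊆ G∩VF=∅ ¬𝒱F⊆𝒱G =
    ¬¬-shift-Fin (λ j → ¬¬-under-premise (G∩VF=∅ j))
      (λ 𝒱F⊆G-members → ¬𝒱F⊆𝒱G (𝒱-greatest 𝒱F⊆G-members))

lemma4p2 : ∀ {c ℓ : Level} (K : Field c ℓ) (n m : ℕ) (H : Fin m → Poly K (suc n)) →
    IsViolatorSpace {m} {c ⊔ ℓ} (Vsolve K H)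
-- Consistency is 𝒱-member; locality is Vsolve-mono in both directions, with
-- 𝒱(G) ⊆ 𝒱(F) from antitonicity (lifted into ¬¬ by `contradiction`) and
-- 𝒱(F) ⊆ 𝒱(G) from disjointness.
lemma4p2 K n m H = record
  { consistency = λ G i Gi 𝒱G⊈hᵢ → 𝒱G⊈hᵢ (𝒱-member Gi)
  ; locality    = λ F G F⊆G G∩VF=∅ i →
      Vsolve-mono (contradiction (𝒱-antitone F⊆G)) i
    , Vsolve-mono (disjoint⇒𝒱⊆ G∩VF=∅) i
  }
  where open Varieties K H
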